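{- Let $\mathbf{A}$ be a distributive nearlattice. Then $\mathbf{A}$ is Stone if and only if every $\alpha$-filter of $A$ is a $\sigma$-filter.
   Context: A distributive nearlattice is a join-semilattice $\langle A,\vee,1\rangle$ with greatest element $1$ in which every principal filter $[a)=\{x\in A\colon a\le x\}$ is a bounded distributive lattice. A filter of $A$ is a subset containing $1$, upward closed, and closed under those binary meets that exist; for filters $F,G$, $F\veebar G$ is the smallest filter containing $F\cup G$. For $a\in A$, $a^{\top}=\{x\in A\colon x\vee a=1\}$ and $a^{\top\top}=\{y\in A\colon y\vee x=1\text{ for all }x\in a^{\top}\}$. A filter $F$ is an $\alpha$-filter if $a^{\top\top}\subseteq F$ for all $a\in F$. For a filter $F$, $\sigma(F)=\{x\in A\colon x^{\top}\veebar F=A\}$, and $F$ is a $\sigma$-filter if $\sigma(F)=F$. $\mathbf{A}$ is Stone if $a^{\top}\veebar a^{\top\top}=A$ for every $a\in A$. -}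

module Defs where

open import Level using (Level; suc; _⊔_)
open import Data.Product using (Σ; _×_; _,_)
open import Relation.Unary using (Pred; _∈_; _⊆_)
open import Relation.Binary.Lattice using (JoinSemilattice)

record IsMeetAbove {c ℓ : Level} (L : JoinSemilattice c ℓ ℓ)
       (a x y z : JoinSemilattice.Carrier L) : Set (c ⊔ ℓ) where
  open JoinSemilattice L
  field
    above    : a ≤ z
    lower₁   : z ≤ x
    lower₂   : z ≤ y
    greatest : ∀ w → a ≤ w → w ≤ x → w ≤ y → w ≤ z

record IsMeet {c ℓ : Level} (L : JoinSemilattice c ℓ ℓ)
       (x y z : JoinSemilattice.Carrier L) : Set (c ⊔ ℓ) where
  open JoinSemilattice L
  field
    lower₁   : z ≤ x
    lower₂   : z ≤ y
    greatest : ∀ w → w ≤ x → w ≤ y → w ≤ z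

-- A distributive nearlattice: a join-semilattice with greatest element 1
-- in which every principal filter [a) is a (bounded) distributive lattice.
-- In [a) the join is the join of A, the bounds are a and 1 (automatic),
-- and the meet is the glb inside [a) (required to exist).
record DistributiveNearlattice (ℓ : Level) : Set (suc ℓ) where
  field
    joinSemilattice : JoinSemilattice ℓ ℓ ℓ
  open JoinSemilattice joinSemilattice public
  field
    𝟏        : Carrier
    maximum  : ∀ x → x ≤ 𝟏
    meetAbove : ∀ a x y → a ≤ x → a ≤ y → Σ Carrier (IsMeetAbove joinSemilattice a x y)
    distribAbove : ∀ a x y z m₁ m₂ m₃ → a ≤ x → a ≤ y → a ≤ z →
                   IsMeetAbove joinSemilattice a x (y ∨ z) m₁ →
                   IsMeetAbove joinSemilattice a x y m₂ →
                   IsMeetAbove joinSemilattice a x z m₃ →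
                   m₁ ≈ (m₂ ∨ m₃)

module _ {ℓ : Level} (A : DistributiveNearlattice ℓ) where
  open DistributiveNearlattice A

  record IsFilter (F : Pred Carrier ℓ) : Set ℓ where
    field
      has-𝟏      : 𝟏 ∈ F
      upClosed   : ∀ {x y} → x ∈ F → x ≤ y → y ∈ F
      meetClosed : ∀ {x y z} → x ∈ F → y ∈ F → IsMeet joinSemilattice x y z → z ∈ F

  _⊻_ : ∀ {ℓ₁ ℓ₂} → Pred Carrier ℓ₁ → Pred Carrier ℓ₂ → Pred Carrier (suc ℓ ⊔ ℓ₁ ⊔ ℓ₂)
  (F ⊻ G) x = ∀ (H : Pred Carrier ℓ) → IsFilter H → F ⊆ H → G ⊆ H → x ∈ H

  _^⊤ : Carrier → Pred Carrier ℓ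
  (a ^⊤) x = (x ∨ a) ≈ 𝟏

  _^⊤⊤ : Carrier → Pred Carrier ℓ
  (a ^⊤⊤) y = ∀ x → x ∈ (a ^⊤) → (y ∨ x) ≈ 𝟏

  IsαFilter : Pred Carrier ℓ → Set ℓ
  IsαFilter F = IsFilter F × (∀ a → a ∈ F → (a ^⊤⊤) ⊆ F)

  σ : Pred Carrier ℓ → Pred Carrier (suc ℓ)
  σ F x = ∀ y → y ∈ ((x ^⊤) ⊻ F)

  IsσFilter : Pred Carrier ℓ → Set (suc ℓ)
  IsσFilter F = IsFilter F × (σ F ⊆ F) × (F ⊆ σ F)

  IsStone : Set (suc ℓ)
  IsStone = ∀ a y → y ∈ ((a ^⊤) ⊻ (a ^⊤⊤))

-- The engine is one distributivity fact: joining with a fixed x preserves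
-- existing meets, (y ∨ x) ∧ (z ∨ x) ≤ (y ∧ z) ∨ x, obtained by computing in
-- the distributive lattice [y ∧ z). It makes a^⊤⊤ and {y | y ∨ x ∈ F} filters.
-- The latter shows σ(F) ⊆ F for every filter F. For an α-filter F ∋ x,
-- a^⊤⊤ ⊆ F turns the Stone identity x^⊤ ⊻ x^⊤⊤ = A into x^⊤ ⊻ F = A.
-- Conversely a^⊤⊤ is an α-filter containing a, so being a σ-filter it gives
-- a^⊤ ⊻ a^⊤⊤ = A.
module Submission where

open import Defs
open import Level using (Level)
open import Relation.Unary using (Pred; _∈_; _⊆_)
open import Function.Bundles using (_⇔_; mk⇔)
open import Data.Product using (_,_; proj₁; proj₂)
import Relation.Binary.Lattice.Properties.JoinSemilattice as JoinSemilatticeProperties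

module _ {ℓ : Level} (A : DistributiveNearlattice ℓ) where
  open DistributiveNearlattice A
  open JoinSemilatticeProperties joinSemilattice using (∨-comm; ∨-monotonic)

  𝟏≤⇒≈𝟏 : ∀ {x} → 𝟏 ≤ x → x ≈ 𝟏
  𝟏≤⇒≈𝟏 = antisym (maximum _)

  ≈𝟏⇒𝟏≤ : ∀ {x} → x ≈ 𝟏 → 𝟏 ≤ x
  ≈𝟏⇒𝟏≤ x≈𝟏 = reflexive (Eq.sym x≈𝟏)

  ∨≈𝟏-comm : ∀ {x y} → (x ∨ y) ≈ 𝟏 → (y ∨ x) ≈ 𝟏
  ∨≈𝟏-comm {x} {y} = Eq.trans (∨-comm y x)

  -- "the meet of p and q in [a) lies below r", without choosing that meet
  MeetAbove≤ : Carrier → Carrier → Carrier → Carrier → Set ℓ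
  MeetAbove≤ a p q r = ∀ t → a ≤ t → t ≤ p → t ≤ q → t ≤ r

  MeetAbove≤-comm : ∀ {a p q r} → MeetAbove≤ a p q r → MeetAbove≤ a q p r
  MeetAbove≤-comm pq≤r t a≤t t≤q t≤p = pq≤r t a≤t t≤p t≤q

  -- p ∧ (q ∨ r) = (p ∧ q) ∨ (p ∧ r) ≤ r ∨ r in [a)
  MeetAbove≤-∨ : ∀ {a p q r} → a ≤ p → a ≤ q → a ≤ r →
                 MeetAbove≤ a p q r → MeetAbove≤ a p (q ∨ r) r
  MeetAbove≤-∨ {a} {p} {q} {r} a≤p a≤q a≤r pq≤r t a≤t t≤p t≤q∨r =
    trans (P∧[Q∨R].greatest t a≤t t≤p t≤q∨r)
          (trans (reflexive distrib) (∨-least m₂≤r P∧R.lower₂))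
    where
    a≤q∨r : a ≤ q ∨ r
    a≤q∨r = trans a≤q (x≤x∨y q r)
    p∧[q∨r] = meetAbove a p (q ∨ r) a≤p a≤q∨r
    p∧q     = meetAbove a p q a≤p a≤q
    p∧r     = meetAbove a p r a≤p a≤r
    module P∧[Q∨R] = IsMeetAbove (proj₂ p∧[q∨r])
    module P∧Q     = IsMeetAbove (proj₂ p∧q)
    module P∧R     = IsMeetAbove (proj₂ p∧r)
    distrib : proj₁ p∧[q∨r] ≈ (proj₁ p∧q ∨ proj₁ p∧r)
    distrib = distribAbove a p q r _ _ _ a≤p a≤q a≤r
                (proj₂ p∧[q∨r]) (proj₂ p∧q) (proj₂ p∧r)
    m₂≤r : proj₁ p∧q ≤ r
    m₂≤r = pq≤r _ P∧Q.above P∧Q.lower₁ P∧Q.lower₂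

  -- In [w) with w = y ∧ z and u = w ∨ x, distributivity gives
  -- (y ∨ u) ∧ (z ∨ u) = (y ∧ z) ∨ u = u.
  ∨-distribʳ-meet : ∀ {y z w} → IsMeet joinSemilattice y z w →
                    ∀ {x v} → v ≤ y ∨ x → v ≤ z ∨ x → v ≤ w ∨ x
  ∨-distribʳ-meet {y} {z} {w} y∧z≈w {x} {v} v≤y∨x v≤z∨x =
    trans (x≤x∨y v w)
          (y∨u∧z∨u≤u (v ∨ w) (y≤x∨y v w) (∨-least v≤y∨u w≤y∨u) (∨-least v≤z∨u w≤z∨u))
    where
    module W = IsMeet y∧z≈w
    u = w ∨ x
    w≤u : w ≤ u
    w≤u = x≤x∨y w x
    w≤y∨u : w ≤ y ∨ u
    w≤y∨u = trans W.lower₁ (x≤x∨y y u)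
    w≤z∨u : w ≤ z ∨ u
    w≤z∨u = trans W.lower₂ (x≤x∨y z u)
    v≤y∨u : v ≤ y ∨ u
    v≤y∨u = trans v≤y∨x (∨-monotonic refl (y≤x∨y w x))
    v≤z∨u : v ≤ z ∨ u
    v≤z∨u = trans v≤z∨x (∨-monotonic refl (y≤x∨y w x))
    z∧y≤u : MeetAbove≤ w z y u
    z∧y≤u t _ t≤z t≤y = trans (W.greatest t t≤y t≤z) w≤u
    z∧y∨u≤u : MeetAbove≤ w z (y ∨ u) u
    z∧y∨u≤u = MeetAbove≤-∨ W.lower₂ W.lower₁ w≤u z∧y≤u
    y∨u∧z∨u≤u : MeetAbove≤ w (y ∨ u) (z ∨ u) u
    y∨u∧z∨u≤u = MeetAbove≤-∨ w≤y∨u W.lower₂ w≤u (MeetAbove≤-comm z∧y∨u≤u)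

  -- anything below p and q lies, after joining with a, in [a)
  IsMeetAbove⇒IsMeet : ∀ {a p q m} → a ≤ p → a ≤ q →
                       IsMeetAbove joinSemilattice a p q m → IsMeet joinSemilattice p q m
  IsMeetAbove⇒IsMeet {a} a≤p a≤q m = record
    { lower₁   = M.lower₁
    ; lower₂   = M.lower₂
    ; greatest = λ v v≤p v≤q →
        trans (x≤x∨y v a) (M.greatest (v ∨ a) (y≤x∨y v a) (∨-least v≤p a≤p) (∨-least v≤q a≤q))
    }
    where module M = IsMeetAbove m

  ^⊤⊤-isFilter : ∀ a → IsFilter A (_^⊤⊤ A a)
  ^⊤⊤-isFilter a = record
    { has-𝟏      = λ x _ → 𝟏≤⇒≈𝟏 (x≤x∨y 𝟏 x)
    ; upClosed   = λ y∈ y≤z x x∈ → 𝟏≤⇒≈𝟏 (trans (≈𝟏⇒𝟏≤ (y∈ x x∈)) (∨-monotonic y≤z refl))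
    ; meetClosed = λ y∈ z∈ y∧z≈w x x∈ →
        𝟏≤⇒≈𝟏 (∨-distribʳ-meet y∧z≈w (≈𝟏⇒𝟏≤ (y∈ x x∈)) (≈𝟏⇒𝟏≤ (z∈ x x∈)))
    }

  ^⊤⊤-isαFilter : ∀ a → IsαFilter A (_^⊤⊤ A a)
  ^⊤⊤-isαFilter a = ^⊤⊤-isFilter a , λ b b∈ c∈ x x∈ → c∈ x (∨≈𝟏-comm (b∈ x x∈))

  ∈^⊤⊤ : ∀ a → a ∈ _^⊤⊤ A a
  ∈^⊤⊤ a x x∈ = ∨≈𝟏-comm x∈

  ∨-preimage-isFilter : ∀ {F} → IsFilter A F → ∀ x → IsFilter A (λ y → (y ∨ x) ∈ F)
  ∨-preimage-isFilter {F} isFilter x = record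
    { has-𝟏      = upClosed has-𝟏 (x≤x∨y 𝟏 x)
    ; upClosed   = λ y∨x∈ y≤z → upClosed y∨x∈ (∨-monotonic y≤z refl)
    ; meetClosed = λ {y} {z} y∨x∈ z∨x∈ y∧z≈w →
        let m = meetAbove x (y ∨ x) (z ∨ x) (y≤x∨y y x) (y≤x∨y z x)
            module M = IsMeetAbove (proj₂ m)
        in upClosed (meetClosed y∨x∈ z∨x∈
                       (IsMeetAbove⇒IsMeet (y≤x∨y y x) (y≤x∨y z x) (proj₂ m)))
                    (∨-distribʳ-meet y∧z≈w M.lower₁ M.lower₂)
    }
    where open IsFilter isFilter

  ⊻-monoʳ : ∀ {ℓ₁ ℓ₂ ℓ₃} {F : Pred Carrier ℓ₁} {G : Pred Carrier ℓ₂} {G′ : Pred Carrier ℓ₃} →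
            G ⊆ G′ → _⊻_ A F G ⊆ _⊻_ A F G′
  ⊻-monoʳ G⊆G′ x∈ H isFilter F⊆H G′⊆H = x∈ H isFilter F⊆H (λ y∈G → G′⊆H (G⊆G′ y∈G))

  σ⊆ : ∀ {F} → IsFilter A F → σ A F ⊆ F
  σ⊆ {F} isFilter {x} x∈σF =
    upClosed (x∈σF x _ (∨-preimage-isFilter isFilter x)
                (λ y∈x^⊤ → upClosed has-𝟏 (≈𝟏⇒𝟏≤ y∈x^⊤))
                (λ {y} y∈F → upClosed y∈F (x≤x∨y y x)))
             (∨-least refl refl)
    where open IsFilter isFilter

  αFilter⊆σ : IsStone A → ∀ {F} → IsαFilter A F → F ⊆ σ A F
  αFilter⊆σ stone (_ , α) x∈F y = ⊻-monoʳ (α _ x∈F) (stone _ y)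

  Stone⇒αFilter⇒σFilter : IsStone A → ∀ F → IsαFilter A F → IsσFilter A F
  Stone⇒αFilter⇒σFilter stone F αF@(isFilter , _) = isFilter , σ⊆ isFilter , αFilter⊆σ stone αF

  αFilter⇒σFilter⇒Stone : (∀ F → IsαFilter A F → IsσFilter A F) → IsStone A
  αFilter⇒σFilter⇒Stone αF⇒σF a = proj₂ (proj₂ (αF⇒σF _ (^⊤⊤-isαFilter a))) (∈^⊤⊤ a)

theorem4p14 : {ℓ : Level} (A : DistributiveNearlattice ℓ) →
    IsStone A ⇔ (∀ (F : Pred (DistributiveNearlattice.Carrier A) ℓ) → IsαFilter A F → IsσFilter A F)
theorem4p14 A = mk⇔ (Stone⇒αFilter⇒σFilter A) (αFilter⇒σFilter⇒Stone A)
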